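{- Let $\alpha(k)$ be the largest odd divisor of $k$, $V(n)=\sum_{k=1}^n\frac{\alpha(k)}{k}$, $G(n)=\sum_{k=1}^n\frac{n+1-k}{k}\alpha(k)$, $v(n)=V(n)-\frac{2n}{3}$ and $g(n)=\frac{n(n+2)}{3}-G(n)$ for $n\ge1$, with $v(0)=g(0)=0$. For $r\ge0$ let $x_r=\frac23(2^{2r}-1)=\sum_{k=0}^{r-1}2^{2k+1}$ and $y_r=2x_r$. Then for all nonnegative integers $p$ and $r$, $$g(2^{2r+2}p+x_{r+1})-g(2^{2r+2}p+y_r)=\frac13\left(1+\frac{1}{2^{2r+1}}\right)\left(\frac13-v(p)\right)$$ and $$g(2^{2r+1}p+x_r)-g(2^{2r+1}p+y_r)=\frac13\left(1-\frac{1}{2^{2r}}\right)\left(v(p)-\frac13\right).$$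
   Context: $\alpha(k)$ is the largest odd divisor of the positive integer $k$. -}

module Defs where

open import Data.Nat as ℕ using (ℕ; zero; suc; _⊔_; _^_)
open import Data.Nat.Divisibility using (_∣_; _∣?_)
open import Data.Integer using (+_)
open import Data.Rational using (ℚ; _/_; _+_; _-_; _*_; 0ℚ)
open import Relation.Nullary using (¬_; yes; no)
open import Relation.Nullary.Decidable using (_×-dec_; ¬?)

OddDivisor : ℕ → ℕ → Set
OddDivisor k d = (d ∣ k) Data.Product.× (¬ (2 ∣ d))
  where import Data.Product

largestOddDivisor≤ : ℕ → ℕ → ℕ
largestOddDivisor≤ k zero = 0
largestOddDivisor≤ k (suc m) with (suc m ∣? k) ×-dec ¬? (2 ∣? suc m)
... | yes _ = suc m
... | no  _ = largestOddDivisor≤ k m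

-- α(k): the largest odd divisor of k (divisors of k ≥ 1 are ≤ k)
α : ℕ → ℕ
α k = largestOddDivisor≤ k k

Σ₁ : ℕ → (ℕ → ℚ) → ℚ
Σ₁ zero    f = 0ℚ
Σ₁ (suc n) f = Σ₁ n f + f (suc n)

V : ℕ → ℚ
V n = Σ₁ n (λ { zero → 0ℚ ; (suc j) → (+ α (suc j)) / suc j })

-- G(n) = Σ_{k=1}^n (n+1-k) α(k) / k   (n+1-k ≥ 1 for k ≤ n, so ∸ is exact)
G : ℕ → ℚ
G n = Σ₁ n (λ { zero → 0ℚ ; (suc j) → (+ ((n ℕ.+ 1 ℕ.∸ suc j) ℕ.* α (suc j))) / suc j })

v : ℕ → ℚ
v zero = 0ℚ
v n@(suc _) = V n - (+ (2 ℕ.* n)) / 3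

g : ℕ → ℚ
g zero = 0ℚ
g n@(suc _) = (+ (n ℕ.* (n ℕ.+ 2))) / 3 - G n

x : ℕ → ℕ
x zero    = 0
x (suc r) = x r ℕ.+ 2 ^ (2 ℕ.* r ℕ.+ 1)

y : ℕ → ℕ
y r = 2 ℕ.* x r

½^ : ℕ → ℚ
½^ zero    = (+ 1) / 1
½^ (suc k) = ((+ 1) / 2) * ½^ k

-- Since α(2k) = α(k) and α(2k+1) = 2k+1, V(2m) = m + V(m)/2 and V(2m+1) = V(2m) + 1, so
-- v(2m) = v(m)/2 and v(2m+1) = v(m)/2 + 1/3; with g(n+1) = g(n) + 1/3 - v(n+1) this gives
-- g(2m+1) = g(m) and g(2m) = g(m) + v(m)/2.  The map m ↦ 4m+2 sends 2^(2r) q + x_r to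
-- 2^(2r+2) q + x_(r+1); along its orbits v contracts by 1/4 towards its fixed point 2/9,
-- while g + v/3 grows by exactly 2/9 per step.  So g and v are explicit on the orbits of p
-- and of 2p, and every argument of g in the theorem is a point of these orbits or twice one.
module Submission where

open import Defs
open import Data.Nat as ℕ using (ℕ; _^_)
open import Data.Integer using (+_)
open import Data.Rational using (ℚ; _/_; _+_; _-_; _*_; 1ℚ)
open import Data.Product using (_×_)
open import Relation.Binary.PropositionalEquality using (_≡_)

open import Data.Nat using (zero; suc; _≤_; _<_; z≤n)
import Data.Nat.Properties as ℕ
open import Data.Nat.Divisibility using (_∣_; _∣?_; divides; ∣-refl; ∣-trans; ∣⇒≤; n∣m*n)
open import Data.Nat.Coprimality using (Coprime; coprime-divisor)
open import Data.Nat.Primality using (irreducible[2])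
open import Data.Nat.GeneralisedArithmetic using (fold)
open import Data.Nat.Tactic.RingSolver using (solve-∀)
open import Data.Integer as ℤ using ()
import Data.Integer.Properties as ℤ
import Data.Integer.Tactic.RingSolver as ℤ
open import Data.Rational using (0ℚ; fromℚᵘ)
open import Data.Rational.Properties
  using (toℚᵘ-injective; toℚᵘ-fromℚᵘ; toℚᵘ-homo-+; toℚᵘ-homo-*; fromℚᵘ-cong; /-cong; *-distribʳ-+)
open import Data.Rational.Unnormalised as ℚᵘ using (mkℚᵘ; *≡*)
import Data.Rational.Unnormalised.Properties as ℚᵘ
open import Data.Rational.Solver using (module +-*-Solver)
open +-*-Solver using (solve; _:=_; _:+_; _:-_; _:*_; con)
open import Data.Product using (_,_; proj₁)
open import Data.Sum using (inj₁; inj₂)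
open import Relation.Nullary using (¬_; yes; no; contradiction)
open import Relation.Nullary.Decidable using (_×-dec_; ¬?)
open import Relation.Binary.PropositionalEquality using (refl; sym; trans; cong; cong₂; module ≡-Reasoning)
open ≡-Reasoning

-- The largest odd divisor

odd⇒coprime-2 : ∀ {d} → ¬ 2 ∣ d → Coprime d 2
odd⇒coprime-2 2∤d (i∣d , i∣2) with irreducible[2] i∣2
... | inj₁ i≡1 = i≡1
... | inj₂ refl = contradiction i∣d 2∤d

2∤1+2k : ∀ k → ¬ 2 ∣ suc (2 ℕ.* k)
2∤1+2k k (divides q eq) = ℕ.even≢odd q k (sym (trans eq (ℕ.*-comm q 2)))

oddDivisor-double : ∀ {n d} → OddDivisor (2 ℕ.* n) d → OddDivisor n d
oddDivisor-double (d∣2n , 2∤d) = coprime-divisor (odd⇒coprime-2 2∤d) d∣2n , 2∤d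

largestOddDivisor≤-self : ∀ {k m} → OddDivisor k m → largestOddDivisor≤ k m ≡ m
largestOddDivisor≤-self {k} {zero} _ = refl
largestOddDivisor≤-self {k} {suc m} odd with (suc m ∣? k) ×-dec ¬? (2 ∣? suc m)
... | yes _ = refl
... | no ¬odd = contradiction odd ¬odd

largestOddDivisor≤-skip : ∀ {a k m} → k ≤ m → (∀ {d} → k < d → d ≤ m → ¬ OddDivisor a d) →
                          largestOddDivisor≤ a m ≡ largestOddDivisor≤ a k
largestOddDivisor≤-skip {m = zero} z≤n none = refl
largestOddDivisor≤-skip {a} {k} {suc m} k≤1+m none with ℕ.m≤n⇒m<n∨m≡n k≤1+m
... | inj₂ refl = refl
... | inj₁ k<1+m with (suc m ∣? a) ×-dec ¬? (2 ∣? suc m)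
...   | yes odd = contradiction odd (none k<1+m ℕ.≤-refl)
...   | no _    = largestOddDivisor≤-skip (ℕ.≤-pred k<1+m) (λ k<d d≤m → none k<d (ℕ.m≤n⇒m≤1+n d≤m))

largestOddDivisor≤-cong : ∀ {a b} → (∀ {d} → OddDivisor a d → OddDivisor b d) →
                          (∀ {d} → OddDivisor b d → OddDivisor a d) →
                          ∀ m → largestOddDivisor≤ a m ≡ largestOddDivisor≤ b m
largestOddDivisor≤-cong a⇒b b⇒a zero = refl
largestOddDivisor≤-cong {a} {b} a⇒b b⇒a (suc m)
  with (suc m ∣? a) ×-dec ¬? (2 ∣? suc m) | (suc m ∣? b) ×-dec ¬? (2 ∣? suc m)
... | yes _   | yes _   = refl
... | yes odd | no ¬odd = contradiction (a⇒b odd) ¬odd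
... | no ¬odd | yes odd = contradiction (b⇒a odd) ¬odd
... | no _    | no _    = largestOddDivisor≤-cong a⇒b b⇒a m

α-odd : ∀ k → α (suc (2 ℕ.* k)) ≡ suc (2 ℕ.* k)
α-odd k = largestOddDivisor≤-self (∣-refl , 2∤1+2k k)

α-double : ∀ n → α (2 ℕ.* suc n) ≡ α (suc n)
α-double n = trans (largestOddDivisor≤-skip (ℕ.m≤m+n (suc n) _) noLargeOddDivisor)
                   (largestOddDivisor≤-cong {2 ℕ.* suc n} {suc n}
                      oddDivisor-double (λ (d∣n , 2∤d) → ∣-trans d∣n (n∣m*n 2) , 2∤d) (suc n))
  where
  noLargeOddDivisor : ∀ {d} → suc n < d → d ≤ 2 ℕ.* suc n → ¬ OddDivisor (2 ℕ.* suc n) d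
  noLargeOddDivisor n<d _ odd = ℕ.<⇒≱ n<d (∣⇒≤ (proj₁ (oddDivisor-double odd)))

-- Fractions with natural numerators

½ ⅓ : ℚ
½ = + 1 / 2
⅓ = + 1 / 3

-- i / suc m is definitionally fromℚᵘ (mkℚᵘ i m), so these compute sums and products of fractions.
fromℚᵘ-homo-+ : ∀ p q → fromℚᵘ (p ℚᵘ.+ q) ≡ fromℚᵘ p + fromℚᵘ q
fromℚᵘ-homo-+ p q = toℚᵘ-injective (ℚᵘ.≃-trans (toℚᵘ-fromℚᵘ (p ℚᵘ.+ q))
  (ℚᵘ.≃-sym (ℚᵘ.≃-trans (toℚᵘ-homo-+ (fromℚᵘ p) (fromℚᵘ q)) (ℚᵘ.+-cong (toℚᵘ-fromℚᵘ p) (toℚᵘ-fromℚᵘ q)))))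

fromℚᵘ-homo-* : ∀ p q → fromℚᵘ (p ℚᵘ.* q) ≡ fromℚᵘ p * fromℚᵘ q
fromℚᵘ-homo-* p q = toℚᵘ-injective (ℚᵘ.≃-trans (toℚᵘ-fromℚᵘ (p ℚᵘ.* q))
  (ℚᵘ.≃-sym (ℚᵘ.≃-trans (toℚᵘ-homo-* (fromℚᵘ p) (fromℚᵘ q)) (ℚᵘ.*-cong (toℚᵘ-fromℚᵘ p) (toℚᵘ-fromℚᵘ q)))))

/-cross : ∀ i j m n → i ℤ.* + suc n ≡ j ℤ.* + suc m → i / suc m ≡ j / suc n
/-cross i j m n eq = fromℚᵘ-cong {mkℚᵘ i m} {mkℚᵘ j n} (*≡* eq)

fromℕ : ℕ → ℚ
fromℕ n = + n / 1

fromℕ-+ : ∀ m n → fromℕ (m ℕ.+ n) ≡ fromℕ m + fromℕ n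
fromℕ-+ m n = trans (/-cross (+ (m ℕ.+ n)) (+ m ℤ.* + 1 ℤ.+ + n ℤ.* + 1) 0 0 cross)
                    (fromℚᵘ-homo-+ (mkℚᵘ (+ m) 0) (mkℚᵘ (+ n) 0))
  where
  ring : ∀ i j → (i ℤ.+ j) ℤ.* + 1 ≡ (i ℤ.* + 1 ℤ.+ j ℤ.* + 1) ℤ.* + 1
  ring = ℤ.solve-∀
  cross : + (m ℕ.+ n) ℤ.* + 1 ≡ (+ m ℤ.* + 1 ℤ.+ + n ℤ.* + 1) ℤ.* + 1
  cross = trans (cong (ℤ._* + 1) (ℤ.pos-+ m n)) (ring (+ m) (+ n))

fromℕ-* : ∀ m n → fromℕ (m ℕ.* n) ≡ fromℕ m * fromℕ n
fromℕ-* m n = trans (cong (_/ 1) (ℤ.pos-* m n)) (fromℚᵘ-homo-* (mkℚᵘ (+ m) 0) (mkℚᵘ (+ n) 0))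

+n/d≡n*1/d : ∀ n d → + n / suc d ≡ fromℕ n * (+ 1 / suc d)
+n/d≡n*1/d n d = trans (/-cross (+ n) (+ n ℤ.* + 1) d (d ℕ.+ 0) cross)
                       (fromℚᵘ-homo-* (mkℚᵘ (+ n) 0) (mkℚᵘ (+ 1) d))
  where
  cross : + n ℤ.* + suc (d ℕ.+ 0) ≡ (+ n ℤ.* + 1) ℤ.* + suc d
  cross = cong₂ ℤ._*_ (sym (ℤ.*-identityʳ (+ n))) (cong (λ k → + suc k) (ℕ.+-identityʳ d))

1/2d≡½*1/d : ∀ d → + 1 / (2 ℕ.* suc d) ≡ ½ * (+ 1 / suc d)
1/2d≡½*1/d d = fromℚᵘ-homo-* (mkℚᵘ (+ 1) 1) (mkℚᵘ (+ 1) d)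

n/n≡1 : ∀ n → + suc n / suc n ≡ 1ℚ
n/n≡1 n = /-cross (+ suc n) (+ 1) n 0 (ℤ.*-comm (+ suc n) (+ 1))

-- Recursions for V, G, v and g

Σ₁-+ : ∀ n {f f₁ f₂ : ℕ → ℚ} → (∀ {j} → j < n → f (suc j) ≡ f₁ (suc j) + f₂ (suc j)) →
       Σ₁ n f ≡ Σ₁ n f₁ + Σ₁ n f₂
Σ₁-+ zero _ = refl
Σ₁-+ (suc n) {f} {f₁} {f₂} pointwise = begin
  Σ₁ n f + f (suc n)
    ≡⟨ cong₂ _+_ (Σ₁-+ n (λ j<n → pointwise (ℕ.m<n⇒m<1+n j<n))) (pointwise ℕ.≤-refl) ⟩
  (Σ₁ n f₁ + Σ₁ n f₂) + (f₁ (suc n) + f₂ (suc n))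
    ≡⟨ solve 4 (λ a b c d → (a :+ b) :+ (c :+ d) := (a :+ c) :+ (b :+ d))
               refl (Σ₁ n f₁) (Σ₁ n f₂) (f₁ (suc n)) (f₂ (suc n)) ⟩
  (Σ₁ n f₁ + f₁ (suc n)) + (Σ₁ n f₂ + f₂ (suc n))
    ∎

/-distrib-+ : ∀ a b d → + (a ℕ.+ b) / suc d ≡ + a / suc d + + b / suc d
/-distrib-+ a b d = begin
  + (a ℕ.+ b) / suc d                     ≡⟨ +n/d≡n*1/d (a ℕ.+ b) d ⟩
  fromℕ (a ℕ.+ b) * r                     ≡⟨ cong (_* r) (fromℕ-+ a b) ⟩
  (fromℕ a + fromℕ b) * r                 ≡⟨ *-distribʳ-+ r (fromℕ a) (fromℕ b) ⟩
  fromℕ a * r + fromℕ b * r               ≡⟨ sym (cong₂ _+_ (+n/d≡n*1/d a d) (+n/d≡n*1/d b d)) ⟩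
  + a / suc d + + b / suc d               ∎
  where
  r : ℚ
  r = + 1 / suc d

+a/2d≡½*a/d : ∀ a d → + a / (2 ℕ.* suc d) ≡ ½ * (+ a / suc d)
+a/2d≡½*a/d a d = begin
  + a / (2 ℕ.* suc d)                ≡⟨ +n/d≡n*1/d a _ ⟩
  fromℕ a * (+ 1 / (2 ℕ.* suc d))    ≡⟨ cong (fromℕ a *_) (1/2d≡½*1/d d) ⟩
  fromℕ a * (½ * r)                  ≡⟨ solve 2 (λ a r → a :* (con ½ :* r) := con ½ :* (a :* r)) refl (fromℕ a) r ⟩
  ½ * (fromℕ a * r)                  ≡⟨ cong (½ *_) (sym (+n/d≡n*1/d a d)) ⟩
  ½ * (+ a / suc d)                  ∎
  where
  r : ℚ
  r = + 1 / suc d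

V-double-suc : ∀ m → V (suc (2 ℕ.* m)) ≡ V (2 ℕ.* m) + 1ℚ
V-double-suc m = cong (λ z → V (2 ℕ.* m) + z)
  (trans (cong (λ a → + a / suc (2 ℕ.* m)) (α-odd m)) (n/n≡1 (2 ℕ.* m)))

V-double : ∀ m → V (2 ℕ.* m) ≡ fromℕ m + ½ * V m
V-double zero = refl
V-double (suc m) = begin
  V (2 ℕ.* suc m)                                           ≡⟨ cong V (ℕ.*-suc 2 m) ⟩
  V (suc (2 ℕ.* m)) + + α (2 ℕ.+ 2 ℕ.* m) / (2 ℕ.+ 2 ℕ.* m)  ≡⟨ cong₂ _+_ (V-double-suc m) lastTerm ⟩
  (V (2 ℕ.* m) + 1ℚ) + ½ * t                                ≡⟨ cong (λ z → (z + 1ℚ) + ½ * t) (V-double m) ⟩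
  ((fromℕ m + ½ * V m) + 1ℚ) + ½ * t
    ≡⟨ solve 3 (λ M W T → ((M :+ con ½ :* W) :+ con 1ℚ) :+ con ½ :* T := (con 1ℚ :+ M) :+ con ½ :* (W :+ T))
               refl (fromℕ m) (V m) t ⟩
  (1ℚ + fromℕ m) + ½ * (V m + t)                            ≡⟨ cong (λ z → z + ½ * V (suc m)) (sym (fromℕ-+ 1 m)) ⟩
  fromℕ (suc m) + ½ * V (suc m)                             ∎
  where
  t : ℚ
  t = + α (suc m) / suc m
  lastTerm : + α (2 ℕ.+ 2 ℕ.* m) / (2 ℕ.+ 2 ℕ.* m) ≡ ½ * t
  lastTerm = begin
    + α (2 ℕ.+ 2 ℕ.* m) / (2 ℕ.+ 2 ℕ.* m)  ≡⟨ /-cong (cong (λ k → + α k) (sym (ℕ.*-suc 2 m))) (sym (ℕ.*-suc 2 m)) ⟩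
    + α (2 ℕ.* suc m) / (2 ℕ.* suc m)      ≡⟨ cong (λ a → + a / (2 ℕ.* suc m)) (α-double m) ⟩
    + α (suc m) / (2 ℕ.* suc m)            ≡⟨ +a/2d≡½*a/d (α (suc m)) m ⟩
    ½ * t                                  ∎

G-suc : ∀ n → G (suc n) ≡ G n + V (suc n)
G-suc n = begin
  G (suc n)                          ≡⟨ cong₂ _+_ (Σ₁-+ n termwise) lastTerm ⟩
  (V n + G n) + + α (suc n) / suc n  ≡⟨ solve 3 (λ W H t → (W :+ H) :+ t := H :+ (W :+ t)) refl (V n) (G n) _ ⟩
  G n + V (suc n)                    ∎
  where
  termwise : ∀ {j} → j < n →
             + ((suc n ℕ.+ 1 ℕ.∸ suc j) ℕ.* α (suc j)) / suc j ≡
             + α (suc j) / suc j + + ((n ℕ.+ 1 ℕ.∸ suc j) ℕ.* α (suc j)) / suc j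
  termwise {j} j<n =
    trans (cong (λ c → + (c ℕ.* α (suc j)) / suc j) (ℕ.+-∸-assoc 1 (ℕ.m≤n⇒m≤n+o 1 j<n)))
          (/-distrib-+ (α (suc j)) _ j)
  lastTerm : + ((suc n ℕ.+ 1 ℕ.∸ suc n) ℕ.* α (suc n)) / suc n ≡ + α (suc n) / suc n
  lastTerm = cong (λ k → + k / suc n)
    (trans (cong (ℕ._* α (suc n)) (ℕ.m+n∸m≡n n 1)) (ℕ.*-identityˡ (α (suc n))))

v≡V-2n/3 : ∀ n → v n ≡ V n - (fromℕ 2 * fromℕ n) * ⅓
v≡V-2n/3 zero = refl
v≡V-2n/3 n@(suc _) = cong (λ z → V n - z)
  (trans (+n/d≡n*1/d (2 ℕ.* n) 2) (cong (_* ⅓) (fromℕ-* 2 n)))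

g≡n[n+2]/3-G : ∀ n → g n ≡ (fromℕ n * (fromℕ n + fromℕ 2)) * ⅓ - G n
g≡n[n+2]/3-G zero = refl
g≡n[n+2]/3-G n@(suc _) = cong (λ z → z - G n)
  (trans (+n/d≡n*1/d (n ℕ.* (n ℕ.+ 2)) 2)
         (cong (_* ⅓) (trans (fromℕ-* n (n ℕ.+ 2)) (cong (fromℕ n *_) (fromℕ-+ n 2)))))

g-suc : ∀ n → g (suc n) ≡ g n + ⅓ - v (suc n)
g-suc n = begin
  g (suc n)
    ≡⟨ g≡n[n+2]/3-G (suc n) ⟩
  (fromℕ (suc n) * (fromℕ (suc n) + two)) * ⅓ - G (suc n)
    ≡⟨ cong₂ (λ M H → (M * (M + two)) * ⅓ - H) (fromℕ-+ 1 n) (G-suc n) ⟩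
  ((1ℚ + N) * ((1ℚ + N) + two)) * ⅓ - (G n + V (suc n))
    ≡⟨ solve 3 (λ N H W → ((con 1ℚ :+ N) :* ((con 1ℚ :+ N) :+ con two)) :* con ⅓ :- (H :+ W)
                        := ((N :* (N :+ con two)) :* con ⅓ :- H) :+ con ⅓ :- (W :- (con two :* (con 1ℚ :+ N)) :* con ⅓))
               refl N (G n) (V (suc n)) ⟩
  ((N * (N + two)) * ⅓ - G n) + ⅓ - (V (suc n) - (two * (1ℚ + N)) * ⅓)
    ≡⟨ sym (cong₂ (λ a b → a + ⅓ - b) (g≡n[n+2]/3-G n) v[1+n]) ⟩
  g n + ⅓ - v (suc n)
    ∎
  where
  N two : ℚ
  N = fromℕ n
  two = fromℕ 2
  v[1+n] : v (suc n) ≡ V (suc n) - (two * (1ℚ + N)) * ⅓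
  v[1+n] = trans (v≡V-2n/3 (suc n)) (cong (λ M → V (suc n) - (two * M) * ⅓) (fromℕ-+ 1 n))

v-double : ∀ m → v (2 ℕ.* m) ≡ ½ * v m
v-double m = begin
  v (2 ℕ.* m)                                  ≡⟨ v≡V-2n/3 (2 ℕ.* m) ⟩
  V (2 ℕ.* m) - (two * fromℕ (2 ℕ.* m)) * ⅓     ≡⟨ cong₂ (λ a b → a - (two * b) * ⅓) (V-double m) (fromℕ-* 2 m) ⟩
  (M + ½ * V m) - (two * (two * M)) * ⅓
    ≡⟨ solve 2 (λ M W → (M :+ con ½ :* W) :- (con two :* (con two :* M)) :* con ⅓
                      := con ½ :* (W :- (con two :* M) :* con ⅓))
               refl M (V m) ⟩
  ½ * (V m - (two * M) * ⅓)                    ≡⟨ cong (½ *_) (sym (v≡V-2n/3 m)) ⟩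
  ½ * v m                                      ∎
  where
  M two : ℚ
  M = fromℕ m
  two = fromℕ 2

v-double-suc : ∀ m → v (suc (2 ℕ.* m)) ≡ ½ * v m + ⅓
v-double-suc m = begin
  v (suc (2 ℕ.* m))                                    ≡⟨ v≡V-2n/3 (suc (2 ℕ.* m)) ⟩
  V (suc (2 ℕ.* m)) - (two * fromℕ (suc (2 ℕ.* m))) * ⅓ ≡⟨ cong₂ (λ a b → a - (two * b) * ⅓) V-expand M-expand ⟩
  ((M + ½ * V m) + 1ℚ) - (two * (1ℚ + two * M)) * ⅓
    ≡⟨ solve 2 (λ M W → ((M :+ con ½ :* W) :+ con 1ℚ) :- (con two :* (con 1ℚ :+ con two :* M)) :* con ⅓
                      := con ½ :* (W :- (con two :* M) :* con ⅓) :+ con ⅓)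
               refl M (V m) ⟩
  ½ * (V m - (two * M) * ⅓) + ⅓                        ≡⟨ cong (λ z → ½ * z + ⅓) (sym (v≡V-2n/3 m)) ⟩
  ½ * v m + ⅓                                          ∎
  where
  M two : ℚ
  M = fromℕ m
  two = fromℕ 2
  V-expand : V (suc (2 ℕ.* m)) ≡ (M + ½ * V m) + 1ℚ
  V-expand = trans (V-double-suc m) (cong (_+ 1ℚ) (V-double m))
  M-expand : fromℕ (suc (2 ℕ.* m)) ≡ 1ℚ + two * M
  M-expand = trans (fromℕ-+ 1 (2 ℕ.* m)) (cong (_+_ 1ℚ) (fromℕ-* 2 m))

g-double : ∀ m → g (2 ℕ.* m) ≡ g m + ½ * v m
g-double-suc : ∀ m → g (suc (2 ℕ.* m)) ≡ g m

g-double zero = refl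
g-double (suc m) = begin
  g (2 ℕ.* suc m)                                  ≡⟨ cong g (ℕ.*-suc 2 m) ⟩
  g (suc (suc (2 ℕ.* m)))                          ≡⟨ g-suc (suc (2 ℕ.* m)) ⟩
  g (suc (2 ℕ.* m)) + ⅓ - v (suc (suc (2 ℕ.* m)))  ≡⟨ cong₂ (λ a b → a + ⅓ - b) (g-double-suc m) v[2+2m] ⟩
  g m + ⅓ - ½ * v (suc m)
    ≡⟨ solve 2 (λ a b → a :+ con ⅓ :- con ½ :* b := (a :+ con ⅓ :- b) :+ con ½ :* b) refl (g m) (v (suc m)) ⟩
  (g m + ⅓ - v (suc m)) + ½ * v (suc m)            ≡⟨ cong (_+ ½ * v (suc m)) (sym (g-suc m)) ⟩
  g (suc m) + ½ * v (suc m)                        ∎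
  where
  v[2+2m] : v (suc (suc (2 ℕ.* m))) ≡ ½ * v (suc m)
  v[2+2m] = trans (cong v (sym (ℕ.*-suc 2 m))) (v-double (suc m))

g-double-suc m = begin
  g (suc (2 ℕ.* m))                    ≡⟨ g-suc (2 ℕ.* m) ⟩
  g (2 ℕ.* m) + ⅓ - v (suc (2 ℕ.* m))  ≡⟨ cong₂ (λ a b → a + ⅓ - b) (g-double m) (v-double-suc m) ⟩
  g m + ½ * v m + ⅓ - (½ * v m + ⅓)
    ≡⟨ solve 2 (λ a b → a :+ con ½ :* b :+ con ⅓ :- (con ½ :* b :+ con ⅓) := a) refl (g m) (v m) ⟩
  g m                                  ∎

-- Orbits of m ↦ 4m + 2

step : ℕ → ℕ
step m = 2 ℕ.* suc (2 ℕ.* m)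

x-suc : ∀ r → x (suc r) ≡ step (x r)
x-suc zero = refl
x-suc (suc r) = begin
  x (suc r) ℕ.+ 2 ^ (2 ℕ.* suc r ℕ.+ 1)  ≡⟨ cong₂ ℕ._+_ (x-suc r) (cong (2 ^_) (exponent r)) ⟩
  step (x r) ℕ.+ 2 ^ (2 ℕ.+ P)          ≡⟨ affine (x r) (2 ^ P) ⟩
  step (x r ℕ.+ 2 ^ P)                  ∎
  where
  P : ℕ
  P = 2 ℕ.* r ℕ.+ 1
  exponent : ∀ r → 2 ℕ.* suc r ℕ.+ 1 ≡ 2 ℕ.+ (2 ℕ.* r ℕ.+ 1)
  exponent = solve-∀
  affine : ∀ X Q → 2 ℕ.* suc (2 ℕ.* X) ℕ.+ 2 ℕ.* (2 ℕ.* Q) ≡ 2 ℕ.* suc (2 ℕ.* (X ℕ.+ Q))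
  affine = solve-∀

fold-step≡2^[2r]q+x : ∀ q r → fold q step r ≡ 2 ^ (2 ℕ.* r) ℕ.* q ℕ.+ x r
fold-step≡2^[2r]q+x q zero = sym (trans (ℕ.+-identityʳ (1 ℕ.* q)) (ℕ.*-identityˡ q))
fold-step≡2^[2r]q+x q (suc r) = begin
  step (fold q step r)                    ≡⟨ cong step (fold-step≡2^[2r]q+x q r) ⟩
  step (E ℕ.* q ℕ.+ x r)                  ≡⟨ affine E q (x r) ⟩
  2 ℕ.* (2 ℕ.* E) ℕ.* q ℕ.+ step (x r)    ≡⟨ cong₂ (λ k X → 2 ^ k ℕ.* q ℕ.+ X) (sym (ℕ.*-suc 2 r)) (sym (x-suc r)) ⟩
  2 ^ (2 ℕ.* suc r) ℕ.* q ℕ.+ x (suc r)   ∎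
  where
  E : ℕ
  E = 2 ^ (2 ℕ.* r)
  affine : ∀ E q X → 2 ℕ.* suc (2 ℕ.* (E ℕ.* q ℕ.+ X)) ≡ 2 ℕ.* (2 ℕ.* E) ℕ.* q ℕ.+ 2 ℕ.* suc (2 ℕ.* X)
  affine = solve-∀

v-step : ∀ m → v (step m) ≡ ½ * (½ * v m + ⅓)
v-step m = trans (v-double (suc (2 ℕ.* m))) (cong (½ *_) (v-double-suc m))

g-step : ∀ m → g (step m) ≡ g m + ½ * (½ * v m + ⅓)
g-step m = trans (g-double (suc (2 ℕ.* m))) (cong₂ (λ a b → a + ½ * b) (g-double-suc m) (v-double-suc m))

φ : ℕ → ℚ
φ m = g m + ⅓ * v m

²⁄₉ : ℚ
²⁄₉ = + 2 / 9

φ-step : ∀ m → φ (step m) ≡ φ m + ²⁄₉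
φ-step m = begin
  g (step m) + ⅓ * v (step m)                          ≡⟨ cong₂ (λ a b → a + ⅓ * b) (g-step m) (v-step m) ⟩
  (g m + ½ * (½ * v m + ⅓)) + ⅓ * (½ * (½ * v m + ⅓))
    ≡⟨ solve 2 (λ a b → (a :+ con ½ :* (con ½ :* b :+ con ⅓)) :+ con ⅓ :* (con ½ :* (con ½ :* b :+ con ⅓))
                      := (a :+ con ⅓ :* b) :+ con ²⁄₉)
               refl (g m) (v m) ⟩
  φ m + ²⁄₉                                            ∎

φ-iterate : ∀ q r → φ (fold q step r) ≡ φ q + fromℕ r * ²⁄₉
φ-iterate q zero = solve 1 (λ a → a := a :+ con 0ℚ :* con ²⁄₉) refl (φ q)
φ-iterate q (suc r) = begin
  φ (step (fold q step r))     ≡⟨ φ-step (fold q step r) ⟩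
  φ (fold q step r) + ²⁄₉      ≡⟨ cong (_+ ²⁄₉) (φ-iterate q r) ⟩
  (φ q + fromℕ r * ²⁄₉) + ²⁄₉
    ≡⟨ solve 2 (λ a n → (a :+ n :* con ²⁄₉) :+ con ²⁄₉ := a :+ (con 1ℚ :+ n) :* con ²⁄₉) refl (φ q) (fromℕ r) ⟩
  φ q + (1ℚ + fromℕ r) * ²⁄₉   ≡⟨ cong (λ n → φ q + n * ²⁄₉) (sym (fromℕ-+ 1 r)) ⟩
  φ q + fromℕ (suc r) * ²⁄₉    ∎

v-iterate : ∀ q r → v (fold q step r) ≡ ²⁄₉ + ½^ (2 ℕ.* r) * (v q - ²⁄₉)
v-iterate q zero = solve 1 (λ a → a := con ²⁄₉ :+ con 1ℚ :* (a :- con ²⁄₉)) refl (v q)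
v-iterate q (suc r) = begin
  v (step (fold q step r))              ≡⟨ v-step (fold q step r) ⟩
  ½ * (½ * v (fold q step r) + ⅓)       ≡⟨ cong (λ a → ½ * (½ * a + ⅓)) (v-iterate q r) ⟩
  ½ * (½ * (²⁄₉ + t * (v q - ²⁄₉)) + ⅓)
    ≡⟨ solve 2 (λ t a → con ½ :* (con ½ :* (con ²⁄₉ :+ t :* (a :- con ²⁄₉)) :+ con ⅓)
                      := con ²⁄₉ :+ con ½ :* (con ½ :* t) :* (a :- con ²⁄₉))
               refl t (v q) ⟩
  ²⁄₉ + ½ * (½ * t) * (v q - ²⁄₉)        ≡⟨ cong (λ k → ²⁄₉ + ½^ k * (v q - ²⁄₉)) (sym (ℕ.*-suc 2 r)) ⟩
  ²⁄₉ + ½^ (2 ℕ.* suc r) * (v q - ²⁄₉)   ∎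
  where
  t : ℚ
  t = ½^ (2 ℕ.* r)

g≡φ-⅓v : ∀ m → g m ≡ φ m - ⅓ * v m
g≡φ-⅓v m = solve 2 (λ a b → a := (a :+ con ⅓ :* b) :- con ⅓ :* b) refl (g m) (v m)

g-fold-double : ∀ p r →
  g (fold (2 ℕ.* p) step r) ≡ g (fold p step r) + ⅓ * ((1ℚ + ½ * ½^ (2 ℕ.* r)) * v p)
g-fold-double p r = begin
  g B
    ≡⟨ g≡φ-⅓v B ⟩
  φ B - ⅓ * v B
    ≡⟨ cong₂ (λ a b → a - ⅓ * b) (φ-iterate (2 ℕ.* p) r) (v-iterate (2 ℕ.* p) r) ⟩
  (φ (2 ℕ.* p) + R) - ⅓ * (²⁄₉ + t * (v (2 ℕ.* p) - ²⁄₉))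
    ≡⟨ cong₂ (λ a b → ((a + ⅓ * b) + R) - ⅓ * (²⁄₉ + t * (b - ²⁄₉))) (g-double p) (v-double p) ⟩
  (((g p + ½ * v p) + ⅓ * (½ * v p)) + R) - ⅓ * (²⁄₉ + t * (½ * v p - ²⁄₉))
    ≡⟨ solve 4 (λ a b R t → (((a :+ con ½ :* b) :+ con ⅓ :* (con ½ :* b)) :+ R)
                              :- con ⅓ :* (con ²⁄₉ :+ t :* (con ½ :* b :- con ²⁄₉))
                          := (((a :+ con ⅓ :* b) :+ R) :- con ⅓ :* (con ²⁄₉ :+ t :* (b :- con ²⁄₉)))
                              :+ con ⅓ :* ((con 1ℚ :+ con ½ :* t) :* b))
               refl (g p) (v p) R t ⟩
  ((φ p + R) - ⅓ * (²⁄₉ + t * (v p - ²⁄₉))) + gap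
    ≡⟨ sym (cong₂ (λ a b → (a - ⅓ * b) + gap) (φ-iterate p r) (v-iterate p r)) ⟩
  (φ A - ⅓ * v A) + gap
    ≡⟨ cong (_+ gap) (sym (g≡φ-⅓v A)) ⟩
  g A + gap
    ∎
  where
  A B : ℕ
  A = fold p step r
  B = fold (2 ℕ.* p) step r
  t R gap : ℚ
  t = ½^ (2 ℕ.* r)
  R = fromℕ r * ²⁄₉
  gap = ⅓ * ((1ℚ + ½ * t) * v p)

g-gap-odd : ∀ p r →
  g (fold (2 ℕ.* p) step r) - g (2 ℕ.* fold p step r) ≡ ⅓ * ((1ℚ - ½^ (2 ℕ.* r)) * (v p - ⅓))
g-gap-odd p r = begin
  g (fold (2 ℕ.* p) step r) - g (2 ℕ.* A)
    ≡⟨ cong₂ _-_ (g-fold-double p r) (g-double A) ⟩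
  (g A + gap) - (g A + ½ * v A)
    ≡⟨ cong (λ b → (g A + gap) - (g A + ½ * b)) (v-iterate p r) ⟩
  (g A + gap) - (g A + ½ * (²⁄₉ + t * (v p - ²⁄₉)))
    ≡⟨ solve 3 (λ a t b → (a :+ con ⅓ :* ((con 1ℚ :+ con ½ :* t) :* b)) :- (a :+ con ½ :* (con ²⁄₉ :+ t :* (b :- con ²⁄₉)))
                        := con ⅓ :* ((con 1ℚ :- t) :* (b :- con ⅓)))
               refl (g A) t (v p) ⟩
  ⅓ * ((1ℚ - t) * (v p - ⅓))
    ∎
  where
  A : ℕ
  A = fold p step r
  t gap : ℚ
  t = ½^ (2 ℕ.* r)
  gap = ⅓ * ((1ℚ + ½ * t) * v p)

g-gap-even : ∀ p r →
  g (fold p step (suc r)) - g (2 ℕ.* fold (2 ℕ.* p) step r) ≡ ⅓ * ((1ℚ + ½ * ½^ (2 ℕ.* r)) * (⅓ - v p))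
g-gap-even p r = begin
  g (step A) - g (2 ℕ.* B)
    ≡⟨ cong₂ _-_ (g-step A) (g-double B) ⟩
  (g A + ½ * (½ * v A + ⅓)) - (g B + ½ * v B)
    ≡⟨ cong₂ (λ a b → (g A + ½ * (½ * a + ⅓)) - b) (v-iterate p r) (cong₂ (λ c d → c + ½ * d) (g-fold-double p r) vB) ⟩
  (g A + ½ * (½ * (²⁄₉ + t * (v p - ²⁄₉)) + ⅓)) - ((g A + gap) + ½ * (²⁄₉ + t * (½ * v p - ²⁄₉)))
    ≡⟨ solve 3 (λ a t b → (a :+ con ½ :* (con ½ :* (con ²⁄₉ :+ t :* (b :- con ²⁄₉)) :+ con ⅓))
                            :- ((a :+ con ⅓ :* ((con 1ℚ :+ con ½ :* t) :* b)) :+ con ½ :* (con ²⁄₉ :+ t :* (con ½ :* b :- con ²⁄₉)))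
                        := con ⅓ :* ((con 1ℚ :+ con ½ :* t) :* (con ⅓ :- b)))
               refl (g A) t (v p) ⟩
  ⅓ * ((1ℚ + ½ * t) * (⅓ - v p))
    ∎
  where
  A B : ℕ
  A = fold p step r
  B = fold (2 ℕ.* p) step r
  t gap : ℚ
  t = ½^ (2 ℕ.* r)
  gap = ⅓ * ((1ℚ + ½ * t) * v p)
  vB : v B ≡ ²⁄₉ + t * (½ * v p - ²⁄₉)
  vB = trans (v-iterate (2 ℕ.* p) r) (cong (λ b → ²⁄₉ + t * (b - ²⁄₉)) (v-double p))

2^[2r+2]p+x[1+r]≡fold : ∀ p r → 2 ^ (2 ℕ.* r ℕ.+ 2) ℕ.* p ℕ.+ x (suc r) ≡ fold p step (suc r)
2^[2r+2]p+x[1+r]≡fold p r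
  rewrite ℕ.^-distribˡ-+-* 2 (2 ℕ.* r) 2 | x-suc r | fold-step≡2^[2r]q+x p r = identity (2 ^ (2 ℕ.* r)) p (x r)
  where
  identity : ∀ E p X → E ℕ.* 4 ℕ.* p ℕ.+ 2 ℕ.* suc (2 ℕ.* X) ≡ 2 ℕ.* suc (2 ℕ.* (E ℕ.* p ℕ.+ X))
  identity = solve-∀

2^[2r+2]p+y[r]≡2*fold : ∀ p r → 2 ^ (2 ℕ.* r ℕ.+ 2) ℕ.* p ℕ.+ y r ≡ 2 ℕ.* fold (2 ℕ.* p) step r
2^[2r+2]p+y[r]≡2*fold p r
  rewrite ℕ.^-distribˡ-+-* 2 (2 ℕ.* r) 2 | fold-step≡2^[2r]q+x (2 ℕ.* p) r = identity (2 ^ (2 ℕ.* r)) p (x r)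
  where
  identity : ∀ E p X → E ℕ.* 4 ℕ.* p ℕ.+ 2 ℕ.* X ≡ 2 ℕ.* (E ℕ.* (2 ℕ.* p) ℕ.+ X)
  identity = solve-∀

2^[2r+1]p+x[r]≡fold : ∀ p r → 2 ^ (2 ℕ.* r ℕ.+ 1) ℕ.* p ℕ.+ x r ≡ fold (2 ℕ.* p) step r
2^[2r+1]p+x[r]≡fold p r
  rewrite ℕ.^-distribˡ-+-* 2 (2 ℕ.* r) 1 | fold-step≡2^[2r]q+x (2 ℕ.* p) r = identity (2 ^ (2 ℕ.* r)) p (x r)
  where
  identity : ∀ E p X → E ℕ.* 2 ℕ.* p ℕ.+ X ≡ E ℕ.* (2 ℕ.* p) ℕ.+ X
  identity = solve-∀

2^[2r+1]p+y[r]≡2*fold : ∀ p r → 2 ^ (2 ℕ.* r ℕ.+ 1) ℕ.* p ℕ.+ y r ≡ 2 ℕ.* fold p step r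
2^[2r+1]p+y[r]≡2*fold p r
  rewrite ℕ.^-distribˡ-+-* 2 (2 ℕ.* r) 1 | fold-step≡2^[2r]q+x p r = identity (2 ^ (2 ℕ.* r)) p (x r)
  where
  identity : ∀ E p X → E ℕ.* 2 ℕ.* p ℕ.+ 2 ℕ.* X ≡ 2 ℕ.* (E ℕ.* p ℕ.+ X)
  identity = solve-∀

lemma2 : (p r : ℕ) →
    (g (2 ^ (2 ℕ.* r ℕ.+ 2) ℕ.* p ℕ.+ x (ℕ.suc r)) - g (2 ^ (2 ℕ.* r ℕ.+ 2) ℕ.* p ℕ.+ y r)
      ≡ ((+ 1) / 3) * ((1ℚ + ½^ (2 ℕ.* r ℕ.+ 1)) * (((+ 1) / 3) - v p)))
    ×
    (g (2 ^ (2 ℕ.* r ℕ.+ 1) ℕ.* p ℕ.+ x r) - g (2 ^ (2 ℕ.* r ℕ.+ 1) ℕ.* p ℕ.+ y r)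
      ≡ ((+ 1) / 3) * ((1ℚ - ½^ (2 ℕ.* r)) * (v p - (+ 1) / 3)))
lemma2 p r =
    trans (cong₂ (λ a b → g a - g b) (2^[2r+2]p+x[1+r]≡fold p r) (2^[2r+2]p+y[r]≡2*fold p r))
          (trans (g-gap-even p r) (cong (λ k → ⅓ * ((1ℚ + ½^ k) * (⅓ - v p))) (ℕ.+-comm 1 (2 ℕ.* r))))
  , trans (cong₂ (λ a b → g a - g b) (2^[2r+1]p+x[r]≡fold p r) (2^[2r+1]p+y[r]≡2*fold p r))
          (g-gap-odd p r)
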